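{- Let $\mathcal{P}$ be a property that distributes over disjoint union. Let $G$ be a disconnected graph with components $G_1,\dots,G_k$, and suppose each $G_i$ admits a $\mathcal{P}$-compelling coloring. Then \[\max_i\Big(\chi_{\mathcal{P}}(G_i)+\sum_{j\ne i} m_{\mathcal{P}}(G_j)\Big)\le \chi_{\mathcal{P}}(G)\le \sum_i \chi_{\mathcal{P}}(G_i).\]
   Context: A property $\mathcal{P}$ assigns to each finite simple graph $H$ a family of subsets of $V(H)$ (those "having $\mathcal{P}$" in $H$). $\mathcal{P}$ distributes over disjoint union if for all graphs $G_1,G_2$ and all $S_1\subseteq V(G_1)$, $S_2\subseteq V(G_2)$, the set $S_1\cup S_2$ has $\mathcal{P}$ in the disjoint union of $G_1$ and $G_2$ if and only if $S_1$ has $\mathcal{P}$ in $G_1$ and $S_2$ has $\mathcal{P}$ in $G_2$. $m_{\mathcal{P}}(H)$ is the minimum cardinality of a subset of $V(H)$ having $\mathcal{P}$ in $H$. A proper coloring partitions the vertex set into nonempty independent color classes; a rainbow committee (RC) is a set consisting of exactly one vertex of each color; a proper coloring is $\mathcal{P}$-compelling if every RC has $\mathcal{P}$; $\chi_{\mathcal{P}}(H)$ is the minimum number of colors in a $\mathcal{P}$-compelling proper coloring of $H$. -}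

module Defs where

open import Data.Nat using (ℕ; zero; suc; _+_; _≤_)
open import Data.Bool using (Bool; true; false)
open import Data.Fin using (Fin; splitAt)
open import Data.Fin.Subset using (Subset; _∈_; ∣_∣)
open import Data.Sum using (_⊎_; inj₁; inj₂)
open import Data.Product using (Σ; Σ-syntax; _×_; _,_; proj₁; proj₂)
open import Data.Vec using (Vec; []; _∷_; _++_)
open import Relation.Binary.PropositionalEquality using (_≡_; _≢_; refl)

record Graph (n : ℕ) : Set where
  field
    adj    : Fin n → Fin n → Bool
    sym    : ∀ u v → adj u v ≡ adj v u
    irrefl : ∀ u → adj u u ≡ false
open Graph public

-- Disjoint union: vertices of G₁ are the first n, those of G₂ the last m
adjS : ∀ {n m} → Graph n → Graph m → Fin n ⊎ Fin m → Fin n ⊎ Fin m → Bool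
adjS G₁ G₂ (inj₁ a) (inj₁ b) = adj G₁ a b
adjS G₁ G₂ (inj₂ a) (inj₂ b) = adj G₂ a b
adjS G₁ G₂ (inj₁ a) (inj₂ b) = false
adjS G₁ G₂ (inj₂ a) (inj₁ b) = false

adjS-sym : ∀ {n m} (G₁ : Graph n) (G₂ : Graph m) x y → adjS G₁ G₂ x y ≡ adjS G₁ G₂ y x
adjS-sym G₁ G₂ (inj₁ a) (inj₁ b) = sym G₁ a b
adjS-sym G₁ G₂ (inj₂ a) (inj₂ b) = sym G₂ a b
adjS-sym G₁ G₂ (inj₁ a) (inj₂ b) = refl
adjS-sym G₁ G₂ (inj₂ a) (inj₁ b) = refl

adjS-irr : ∀ {n m} (G₁ : Graph n) (G₂ : Graph m) x → adjS G₁ G₂ x x ≡ false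
adjS-irr G₁ G₂ (inj₁ a) = irrefl G₁ a
adjS-irr G₁ G₂ (inj₂ a) = irrefl G₂ a

_⊕_ : ∀ {n m} → Graph n → Graph m → Graph (n + m)
_⊕_ {n} G₁ G₂ = record
  { adj    = λ u v → adjS G₁ G₂ (splitAt n u) (splitAt n v)
  ; sym    = λ u v → adjS-sym G₁ G₂ (splitAt n u) (splitAt n v)
  ; irrefl = λ u → adjS-irr G₁ G₂ (splitAt n u)
  }

-- Properties: a property assigns to each (nonempty) finite simple graph H
-- a family of subsets of V(H), given by its (Boolean) characteristic function.

Property : Set
Property = ∀ {n} → Graph n → Subset n → Bool

Has : Property → ∀ {n} → Graph n → Subset n → Set
Has P H S = P H S ≡ true

Distributes : Property → Set
Distributes P = ∀ {n m} (G₁ : Graph (suc n)) (G₂ : Graph (suc m))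
  (S₁ : Subset (suc n)) (S₂ : Subset (suc m)) →
  (Has P (G₁ ⊕ G₂) (S₁ ++ S₂) → Has P G₁ S₁ × Has P G₂ S₂) ×
  (Has P G₁ S₁ × Has P G₂ S₂ → Has P (G₁ ⊕ G₂) (S₁ ++ S₂))

data Reachable {n} (G : Graph n) : Fin n → Fin n → Set where
  here : ∀ {u} → Reachable G u u
  step : ∀ {u w v} → adj G u w ≡ true → Reachable G w v → Reachable G u v

Connected : ∀ {n} → Graph n → Set
Connected G = ∀ u v → Reachable G u v

record ProperColoring {n} (G : Graph n) (r : ℕ) : Set where
  field
    col      : Fin n → Fin r
    onto     : ∀ (j : Fin r) → Σ[ v ∈ Fin n ] col v ≡ j
    proper   : ∀ u v → adj G u v ≡ true → col u ≢ col v
open ProperColoring public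

IsRC : ∀ {n r} {G : Graph n} → ProperColoring G r → Subset n → Set
IsRC {n} {r} c S = ∀ (j : Fin r) →
  Σ[ v ∈ Fin n ] ((v ∈ S × col c v ≡ j) × (∀ w → w ∈ S → col c w ≡ j → w ≡ v))

Compelling : Property → ∀ {n r} {G : Graph n} → ProperColoring G r → Set
Compelling P {n} {G = G} c = ∀ (S : Subset n) → IsRC c S → Has P G S

HasCompelling : Property → ∀ {n} → Graph n → ℕ → Set
HasCompelling P G r = Σ[ c ∈ ProperColoring G r ] Compelling P c

IsChiP : Property → ∀ {n} → Graph n → ℕ → Set
IsChiP P G r = HasCompelling P G r × (∀ r' → HasCompelling P G r' → r ≤ r')

IsMP : Property → ∀ {n} → Graph n → ℕ → Set
IsMP P {n} G m = (Σ[ S ∈ Subset n ] (Has P G S × ∣ S ∣ ≡ m)) ×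
                 (∀ (S : Subset n) → Has P G S → m ≤ ∣ S ∣)

Comp : Set
Comp = Σ[ n ∈ ℕ ] Graph (suc n)

cgraph : (c : Comp) → Graph (suc (proj₁ c))
cgraph c = proj₂ c

unionSize : ∀ {k} → Vec Comp (suc k) → ℕ
unionSize {zero}  (c ∷ [])  = suc (proj₁ c)
unionSize {suc k} (c ∷ cs)  = suc (proj₁ c) + unionSize cs

⨆ : ∀ {k} → (cs : Vec Comp (suc k)) → Graph (unionSize cs)
⨆ {zero}  (c ∷ [])  = cgraph c
⨆ {suc k} (c ∷ cs)  = cgraph c ⊕ ⨆ cs

-- Upper bound: compelling colorings of the components, on disjoint palettes, combine into one of
-- the union, since by distributivity a set has P in G ⊕ H exactly when both of its parts do.
-- Lower bound: fix a compelling coloring of G and a component Gᵢ, and pick one representative vertex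
-- for each color missing on Gᵢ. Adding these representatives to a rainbow committee of the
-- restriction to Gᵢ yields a rainbow committee of G, which has P. So the restriction, with its unused
-- colors discarded, is a compelling coloring of Gᵢ and uses at least χ_P(Gᵢ) colors, while the
-- representatives have P in the remaining components and hence number at least ∑_{j≠i} m_P(Gⱼ).
-- The minimum χ_P(G) exists because having a compelling r-coloring is decidable.

module Submission where

open import Defs hiding (sym)
open import Data.Nat using (ℕ; zero; suc; _+_; _≤_; _<_; z≤n; s≤s)
open import Data.Nat.Properties
  using (≤-trans; ≤-refl; ≤-reflexive; ≤-antisym; <⇒≤; ≮⇒≥; +-mono-≤; +-identityʳ; anyUpTo?;
         +-commutativeSemigroup; module ≤-Reasoning)
open import Data.Nat.Induction using (<-rec)
open import Data.Bool as Bool using (true; false)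
open import Data.Fin
  using (Fin; zero; suc; _↑ˡ_; _↑ʳ_; splitAt; join; punchIn; punchOut; _≟_; finToFun; funToFin)
open import Data.Fin.Properties
  using (0≢1+n; ↑ˡ-injective; ↑ʳ-injective; splitAt-↑ˡ; splitAt-↑ʳ; suc-injective; any?; all?; ¬∀⟶∃¬;
         punchIn-injective; punchIn-punchOut; finToFun-funToFin)
open import Data.Fin.Subset using (Subset; _∈_; _-_; ⊤; ∣_∣)
open import Data.Fin.Subset.Properties
  using (_∈?_; ∈⊤; ∣⊤∣≡n; x∈p⇒∣p-x∣<∣p∣; x∈p∧x≢y⇒x∈p-y; anySubset?)
open import Data.Vec using (Vec; []; _∷_; _++_; lookup; tabulate; sum; removeAt; here; there)
open import Data.Vec.Properties using (lookup⇒[]=; []=⇒lookup; lookup∘tabulate)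
import Data.Vec as Vec
open import Data.Sum using (_⊎_; inj₁; inj₂)
import Data.Sum as Sum
open import Data.Product using (Σ-syntax; ∃; _×_; _,_; proj₁; proj₂)
open import Data.Empty using (⊥-elim)
open import Function using (_∘_; id)
open import Function.Definitions using (Injective)
open import Relation.Nullary using (Dec; yes; no; ¬_; does; ¬?)
open import Relation.Nullary.Decidable using (_×-dec_; _→-dec_; map′; decidable-stable)
open import Relation.Binary.PropositionalEquality
  using (_≡_; _≢_; refl; sym; trans; cong; subst; _≗_; module ≡-Reasoning)
open import Algebra.Properties.CommutativeSemigroup +-commutativeSemigroup using (x∙yz≈y∙xz)

private variable
  k n m r : ℕ

data SplitView (n m : ℕ) : Fin (n + m) → Set where
  inl : (a : Fin n) → SplitView n m (a ↑ˡ m)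
  inr : (b : Fin m) → SplitView n m (n ↑ʳ b)

splitView : ∀ n {m} (v : Fin (n + m)) → SplitView n m v
splitView zero    v       = inr v
splitView (suc n) zero    = inl zero
splitView (suc n) (suc v) with splitView n v
... | inl a = inl (suc a)
... | inr b = inr b

↑ˡ≢↑ʳ : (a : Fin n) (b : Fin m) → a ↑ˡ m ≢ n ↑ʳ b
↑ˡ≢↑ʳ {n} {m} a b eq
  with () ← trans (sym (splitAt-↑ˡ n a m)) (trans (cong (splitAt n) eq) (splitAt-↑ʳ n m b))

∈-++⁺ˡ : {p : Subset n} {q : Subset m} {a : Fin n} → a ∈ p → a ↑ˡ m ∈ p ++ q
∈-++⁺ˡ here      = here
∈-++⁺ˡ (there a) = there (∈-++⁺ˡ a)

∈-++⁻ˡ : (p : Subset n) {q : Subset m} {a : Fin n} → a ↑ˡ m ∈ p ++ q → a ∈ p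
∈-++⁻ˡ (_ ∷ p) {a = zero}  here      = here
∈-++⁻ˡ (_ ∷ p) {a = suc a} (there x) = there (∈-++⁻ˡ p x)

∈-++⁺ʳ : (p : Subset n) {q : Subset m} {b : Fin m} → b ∈ q → n ↑ʳ b ∈ p ++ q
∈-++⁺ʳ []      x = x
∈-++⁺ʳ (_ ∷ p) x = there (∈-++⁺ʳ p x)

∈-++⁻ʳ : (p : Subset n) {q : Subset m} {b : Fin m} → n ↑ʳ b ∈ p ++ q → b ∈ q
∈-++⁻ʳ []      x         = x
∈-++⁻ʳ (_ ∷ p) (there x) = ∈-++⁻ʳ p x

module _ {Q : Fin n → Set} (Q? : ∀ x → Dec (Q x)) where

  ∈-tabulate⁺ : ∀ {x} → Q x → x ∈ tabulate (does ∘ Q?)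
  ∈-tabulate⁺ {x} qx with Q? x in eq
  ... | yes _ = lookup⇒[]= x _ (trans (lookup∘tabulate (does ∘ Q?) x) (cong does eq))
  ... | no ¬qx = ⊥-elim (¬qx qx)

  ∈-tabulate⁻ : ∀ {x} → x ∈ tabulate (does ∘ Q?) → Q x
  ∈-tabulate⁻ {x} x∈ with Q? x | trans (sym (lookup∘tabulate (does ∘ Q?) x)) ([]=⇒lookup x∈)
  ... | yes qx | _ = qx

∣p++q∣≡∣p∣+∣q∣ : (p : Subset n) (q : Subset m) → ∣ p ++ q ∣ ≡ ∣ p ∣ + ∣ q ∣
∣p++q∣≡∣p∣+∣q∣ []          q = refl
∣p++q∣≡∣p∣+∣q∣ (true ∷ p)  q = cong suc (∣p++q∣≡∣p∣+∣q∣ p q)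
∣p++q∣≡∣p∣+∣q∣ (false ∷ p) q = ∣p++q∣≡∣p∣+∣q∣ p q

InjectiveOn : (Fin n → Fin m) → Subset n → Set
InjectiveOn f S = ∀ {u w} → u ∈ S → w ∈ S → f u ≡ f w → u ≡ w

injectiveOn⇒∣p∣≤∣q∣ : {p : Subset k} {q : Subset n} (h : Fin k → Fin n) →
  (∀ {x} → x ∈ p → h x ∈ q) → InjectiveOn h p → ∣ p ∣ ≤ ∣ q ∣
injectiveOn⇒∣p∣≤∣q∣ {p = []} h into inj = z≤n
injectiveOn⇒∣p∣≤∣q∣ {p = false ∷ p} h into inj =
  injectiveOn⇒∣p∣≤∣q∣ (h ∘ suc) (into ∘ there) λ x y e → suc-injective (inj (there x) (there y) e)
injectiveOn⇒∣p∣≤∣q∣ {p = true ∷ p} {q} h into inj = ≤-trans (s≤s rest) (x∈p⇒∣p-x∣<∣p∣ (into here))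
  where
  rest : ∣ p ∣ ≤ ∣ q - h zero ∣
  rest = injectiveOn⇒∣p∣≤∣q∣ (h ∘ suc)
    (λ x → x∈p∧x≢y⇒x∈p-y (into (there x)) λ e → 0≢1+n (inj here (there x) (sym e)))
    (λ x y e → suc-injective (inj (there x) (there y) e))

injectiveOn-++ : {f : Fin (n + m) → Fin r} {S : Subset n} {T : Subset m} →
  InjectiveOn (f ∘ (_↑ˡ m)) S → InjectiveOn (f ∘ (n ↑ʳ_)) T →
  (∀ {a b} → a ∈ S → b ∈ T → f (a ↑ˡ m) ≢ f (n ↑ʳ b)) → InjectiveOn f (S ++ T)
injectiveOn-++ {n = n} {m} {S = S} injˡ injʳ disjoint {u} {w} u∈ w∈ eq with splitView n u | splitView n w
... | inl a | inl a′ = cong (_↑ˡ m) (injˡ (∈-++⁻ˡ S u∈) (∈-++⁻ˡ S w∈) eq)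
... | inl a | inr b  = ⊥-elim (disjoint (∈-++⁻ˡ S u∈) (∈-++⁻ʳ S w∈) eq)
... | inr b | inl a  = ⊥-elim (disjoint (∈-++⁻ˡ S w∈) (∈-++⁻ʳ S u∈) (sym eq))
... | inr b | inr b′ = cong (n ↑ʳ_) (injʳ (∈-++⁻ʳ S u∈) (∈-++⁻ʳ S w∈) eq)

Proper : Graph n → (Fin n → Fin r) → Set
Proper G f = ∀ u v → adj G u v ≡ true → f u ≢ f v

-- Rainbow committees of maps that need not be onto, as restrictions of a coloring to a component are not.
record IsRainbow (f : Fin n → Fin r) (S : Subset n) : Set where
  field
    hits        : ∀ v → ∃ λ u → u ∈ S × f u ≡ f v
    injectiveOn : InjectiveOn f S
open IsRainbow

Compels : Property → Graph n → (Fin n → Fin r) → Set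
Compels P G f = ∀ S → IsRainbow f S → Has P G S

module _ {G : Graph n} (c : ProperColoring G r) where

  IsRC⇒IsRainbow : ∀ {S} → IsRC c S → IsRainbow (col c) S
  IsRC⇒IsRainbow rc .hits v with rc (col c v)
  ... | u , (u∈S , eq) , _ = u , u∈S , eq
  IsRC⇒IsRainbow rc .injectiveOn {u} {w} u∈S w∈S eq =
    let (_ , _ , unique) = rc (col c w) in trans (unique u u∈S eq) (sym (unique w w∈S refl))

  IsRainbow⇒IsRC : ∀ {S} → IsRainbow (col c) S → IsRC c S
  IsRainbow⇒IsRC rb j =
    let (v , cv≡j) = onto c j
        (u , u∈S , cu≡cv) = rb .hits v
        cu≡j = trans cu≡cv cv≡j
    in u , (u∈S , cu≡j) , λ w w∈S cw≡j → rb .injectiveOn w∈S u∈S (trans cw≡j (sym cu≡j))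

  IsRC⇒∣S∣≡r : ∀ {S} → IsRC c S → ∣ S ∣ ≡ r
  IsRC⇒∣S∣≡r {S} rc = ≤-antisym
    (≤-trans (injectiveOn⇒∣p∣≤∣q∣ (col c) (λ _ → ∈⊤) (IsRC⇒IsRainbow rc .injectiveOn))
             (≤-reflexive (∣⊤∣≡n r)))
    (≤-trans (≤-reflexive (sym (∣⊤∣≡n r)))
             (injectiveOn⇒∣p∣≤∣q∣ member (λ {j} _ → member∈S j) member-injective))
    where
    member : Fin r → Fin n
    member j = proj₁ (rc j)
    member∈S : ∀ j → member j ∈ S
    member∈S j = proj₁ (proj₁ (proj₂ (rc j)))
    member-injective : InjectiveOn member ⊤
    member-injective {i} {j} _ _ eq =
      trans (sym (proj₂ (proj₁ (proj₂ (rc i))))) (trans (cong (col c) eq) (proj₂ (proj₁ (proj₂ (rc j)))))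

record ImageFactorisation (f : Fin n → Fin r) : Set where
  field
    size       : ℕ
    surjection : Fin n → Fin size
    surjective : ∀ j → ∃ λ v → surjection v ≡ j
    injection  : Fin size → Fin r
    injective  : Injective _≡_ _≡_ injection
    factors    : ∀ v → injection (surjection v) ≡ f v

imageFactorisation : (f : Fin n → Fin r) → ImageFactorisation f
imageFactorisation {r = r} f with all? (λ j → any? (λ v → f v ≟ j))
... | yes surjective = record
  { size = r ; surjection = f ; surjective = surjective
  ; injection = id ; injective = id ; factors = λ _ → refl }
imageFactorisation {r = zero}  f | no ¬surjective = ⊥-elim (¬surjective λ ())
imageFactorisation {r = suc r} f | no ¬surjective = record
  { size       = size
  ; surjection = surjection
  ; surjective = surjective
  ; injection  = punchIn j ∘ injection
  ; injective  = injective ∘ punchIn-injective j _ _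
  ; factors    = λ v → trans (cong (punchIn j) (factors v)) (punchIn-punchOut (j≢f v))
  }
  where
  missing : ∃ λ j → ¬ ∃ λ v → f v ≡ j
  missing = ¬∀⟶∃¬ _ _ (λ j → any? (λ v → f v ≟ j)) ¬surjective
  j : Fin (suc r)
  j = proj₁ missing
  j≢f : ∀ v → j ≢ f v
  j≢f v eq = proj₂ missing (v , sym eq)
  open ImageFactorisation (imageFactorisation (λ v → punchOut (j≢f v)))

IsRainbow-∘-injective : {e : Fin n → Fin k} {g : Fin k → Fin r} {f : Fin n → Fin r} {S : Subset n} →
  Injective _≡_ _≡_ g → (∀ v → g (e v) ≡ f v) → IsRainbow e S → IsRainbow f S
IsRainbow-∘-injective {g = g} _ factors rb .hits v =
  let (u , u∈S , eu≡ev) = rb .hits v in u , u∈S , trans (sym (factors u)) (trans (cong g eu≡ev) (factors v))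
IsRainbow-∘-injective g-inj factors rb .injectiveOn u∈S w∈S fu≡fw =
  rb .injectiveOn u∈S w∈S (g-inj (trans (factors _) (trans fu≡fw (sym (factors _)))))

module _ (P : Property) where

  compellingImage : {G : Graph n} {f : Fin n → Fin r} → Proper G f → Compels P G f →
    Σ[ r′ ∈ ℕ ] Σ[ hc ∈ HasCompelling P G r′ ] (∀ {S} → IsRC (proj₁ hc) S → IsRainbow f S)
  compellingImage {G = G} {f} f-proper f-compels =
    size , (c , λ S → f-compels S ∘ IsRC⇒IsRainbow′) , IsRC⇒IsRainbow′
    where
    open ImageFactorisation (imageFactorisation f)
    c : ProperColoring G size
    c = record
      { col    = surjection
      ; onto   = surjective
      ; proper = λ u v uv eq → f-proper u v uv (trans (sym (factors u)) (trans (cong injection eq) (factors v)))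
      }
    IsRC⇒IsRainbow′ : ∀ {S} → IsRC c S → IsRainbow f S
    IsRC⇒IsRainbow′ = IsRainbow-∘-injective injective factors ∘ IsRC⇒IsRainbow c

module Representatives {N r} (f : Fin N → Fin r) (surjective : ∀ j → ∃ λ v → f v ≡ j)
  {k l} (ι : Fin k → Fin N) (ι-injective : Injective _≡_ _≡_ ι) (other : Fin l → Fin r)
  (covers : ∀ v → (∃ λ x → ι x ≡ v) ⊎ (∃ λ y → other y ≡ f v)) where

  -- Taking the vertex named by the surjectivity proof makes the representative of a color unique.
  representative : Fin r → Fin N
  representative j = proj₁ (surjective j)

  Fresh : Fin k → Set
  Fresh x = representative (f (ι x)) ≡ ι x × ¬ ∃ λ y → other y ≡ f (ι x)

  fresh? : ∀ x → Dec (Fresh x)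
  fresh? x = (representative (f (ι x)) ≟ ι x) ×-dec ¬? (any? λ y → other y ≟ f (ι x))

  fresh : Subset k
  fresh = tabulate (does ∘ fresh?)

  fresh-unused : ∀ {x} → x ∈ fresh → ¬ ∃ λ y → other y ≡ f (ι x)
  fresh-unused = proj₂ ∘ ∈-tabulate⁻ fresh?

  fresh-injective : InjectiveOn (f ∘ ι) fresh
  fresh-injective x∈ x′∈ eq = ι-injective (trans (sym (proj₁ (∈-tabulate⁻ fresh? x∈)))
    (trans (cong representative eq) (proj₁ (∈-tabulate⁻ fresh? x′∈))))

  fresh-hits : ∀ v → ¬ ∃ (λ y → other y ≡ f v) → ∃ λ x → x ∈ fresh × f (ι x) ≡ f v
  fresh-hits v unused with covers (representative (f v))
  ... | inj₂ (y , oy≡f-rep) = ⊥-elim (unused (y , trans oy≡f-rep (proj₂ (surjective (f v)))))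
  ... | inj₁ (x , ιx≡rep) = x , ∈-tabulate⁺ fresh? (representative-ιx , unused ∘ used) , fιx≡fv
    where
    fιx≡fv : f (ι x) ≡ f v
    fιx≡fv = trans (cong f ιx≡rep) (proj₂ (surjective (f v)))
    representative-ιx : representative (f (ι x)) ≡ ι x
    representative-ιx = trans (cong representative fιx≡fv) (sym ιx≡rep)
    used : ∃ (λ y → other y ≡ f (ι x)) → ∃ (λ y → other y ≡ f v)
    used (y , eq) = y , trans eq fιx≡fv

  completes : ∀ {T} → IsRainbow other T → ∀ v →
    (∃ λ y → y ∈ T × other y ≡ f v) ⊎ (∃ λ x → x ∈ fresh × f (ι x) ≡ f v)
  completes rb v with any? (λ y → other y ≟ f v)
  ... | yes (y , oy≡fv) = let (y′ , y′∈T , eq) = rb .hits y in inj₁ (y′ , y′∈T , trans eq oy≡fv)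
  ... | no unused       = inj₂ (fresh-hits v unused)

rainbowCommittee : {G : Graph n} (c : ProperColoring G r) → Σ[ S ∈ Subset n ] IsRC c S
rainbowCommittee c = fresh , IsRainbow⇒IsRC c record
  { hits        = λ v → fresh-hits v λ { (() , _) }
  ; injectiveOn = fresh-injective
  }
  where open Representatives (col c) (onto c) {l = 0} id id (λ ()) (λ v → inj₁ (v , refl))

module _ {f : Fin (n + m) → Fin r} (surjective : ∀ j → ∃ λ v → f v ≡ j) where

  private
    fˡ : Fin n → Fin r
    fˡ = f ∘ (_↑ˡ m)

    fʳ : Fin m → Fin r
    fʳ = f ∘ (n ↑ʳ_)

    coversˡ : ∀ v → (∃ λ a → a ↑ˡ m ≡ v) ⊎ (∃ λ b → fʳ b ≡ f v)
    coversˡ v with splitView n v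
    ... | inl a = inj₁ (a , refl)
    ... | inr b = inj₂ (b , refl)

    coversʳ : ∀ v → (∃ λ b → n ↑ʳ b ≡ v) ⊎ (∃ λ a → fˡ a ≡ f v)
    coversʳ v with splitView n v
    ... | inl a = inj₂ (a , refl)
    ... | inr b = inj₁ (b , refl)

    module L = Representatives f surjective (_↑ˡ m) (↑ˡ-injective m _ _) fʳ coversˡ
    module R = Representatives f surjective (n ↑ʳ_) (↑ʳ-injective n _ _) fˡ coversʳ

  freshˡ : Subset n
  freshˡ = L.fresh

  freshʳ : Subset m
  freshʳ = R.fresh

  extendʳ : ∀ {S} → IsRainbow fˡ S → IsRainbow f (S ++ freshʳ)
  extendʳ {S} rb .hits v with R.completes rb v
  ... | inj₁ (a , a∈S , eq) = a ↑ˡ m , ∈-++⁺ˡ a∈S , eq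
  ... | inj₂ (b , b∈ , eq)  = n ↑ʳ b , ∈-++⁺ʳ S b∈ , eq
  extendʳ rb .injectiveOn =
    injectiveOn-++ (rb .injectiveOn) R.fresh-injective λ _ b∈ eq → R.fresh-unused b∈ (_ , eq)

  extendˡ : ∀ {T} → IsRainbow fʳ T → IsRainbow f (freshˡ ++ T)
  extendˡ rb .hits v with L.completes rb v
  ... | inj₁ (b , b∈T , eq) = n ↑ʳ b , ∈-++⁺ʳ freshˡ b∈T , eq
  ... | inj₂ (a , a∈ , eq)  = a ↑ˡ m , ∈-++⁺ˡ a∈ , eq
  extendˡ rb .injectiveOn =
    injectiveOn-++ L.fresh-injective (rb .injectiveOn) λ a∈ _ eq → L.fresh-unused a∈ (_ , sym eq)

module _ (G : Graph n) (H : Graph m) where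

  adj-⊕-↑ˡ : ∀ a a′ → adj (G ⊕ H) (a ↑ˡ m) (a′ ↑ˡ m) ≡ adj G a a′
  adj-⊕-↑ˡ a a′ rewrite splitAt-↑ˡ n a m | splitAt-↑ˡ n a′ m = refl

  adj-⊕-↑ʳ : ∀ b b′ → adj (G ⊕ H) (n ↑ʳ b) (n ↑ʳ b′) ≡ adj H b b′
  adj-⊕-↑ʳ b b′ rewrite splitAt-↑ʳ n m b | splitAt-↑ʳ n m b′ = refl

  adj-⊕-↑ˡ↑ʳ : ∀ a b → adj (G ⊕ H) (a ↑ˡ m) (n ↑ʳ b) ≡ false
  adj-⊕-↑ˡ↑ʳ a b rewrite splitAt-↑ˡ n a m | splitAt-↑ʳ n m b = refl

  adj-⊕-↑ʳ↑ˡ : ∀ b a → adj (G ⊕ H) (n ↑ʳ b) (a ↑ˡ m) ≡ false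
  adj-⊕-↑ʳ↑ˡ b a rewrite splitAt-↑ˡ n a m | splitAt-↑ʳ n m b = refl

  proper-↑ˡ : {f : Fin (n + m) → Fin r} → Proper (G ⊕ H) f → Proper G (f ∘ (_↑ˡ m))
  proper-↑ˡ f-proper a a′ = f-proper _ _ ∘ trans (adj-⊕-↑ˡ a a′)

  proper-↑ʳ : {f : Fin (n + m) → Fin r} → Proper (G ⊕ H) f → Proper H (f ∘ (n ↑ʳ_))
  proper-↑ʳ f-proper b b′ = f-proper _ _ ∘ trans (adj-⊕-↑ʳ b b′)

_⊕ᶠ_ : {r₁ r₂ : ℕ} → (Fin n → Fin r₁) → (Fin m → Fin r₂) → Fin (n + m) → Fin (r₁ + r₂)
_⊕ᶠ_ {n} {r₁ = r₁} {r₂} f g v = join r₁ r₂ (Sum.map f g (splitAt n v))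

module _ {r₁ r₂ : ℕ} (f : Fin n → Fin r₁) (g : Fin m → Fin r₂) where

  ⊕ᶠ-↑ˡ : ∀ a → (f ⊕ᶠ g) (a ↑ˡ m) ≡ f a ↑ˡ r₂
  ⊕ᶠ-↑ˡ a rewrite splitAt-↑ˡ n a m = refl

  ⊕ᶠ-↑ʳ : ∀ b → (f ⊕ᶠ g) (n ↑ʳ b) ≡ r₁ ↑ʳ g b
  ⊕ᶠ-↑ʳ b rewrite splitAt-↑ʳ n m b = refl

  IsRainbow-⊕ᶠ⁻ˡ : ∀ {S T} → IsRainbow (f ⊕ᶠ g) (S ++ T) → IsRainbow f S
  IsRainbow-⊕ᶠ⁻ˡ {S} rb .hits a with rb .hits (a ↑ˡ m)
  ... | u , u∈ , eq with splitView n u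
  ...   | inl a′ = a′ , ∈-++⁻ˡ S u∈ ,
                   ↑ˡ-injective r₂ _ _ (trans (sym (⊕ᶠ-↑ˡ a′)) (trans eq (⊕ᶠ-↑ˡ a)))
  ...   | inr b  = ⊥-elim (↑ˡ≢↑ʳ (f a) (g b) (trans (sym (⊕ᶠ-↑ˡ a)) (trans (sym eq) (⊕ᶠ-↑ʳ b))))
  IsRainbow-⊕ᶠ⁻ˡ rb .injectiveOn a∈ a′∈ eq =
    ↑ˡ-injective m _ _ (rb .injectiveOn (∈-++⁺ˡ a∈) (∈-++⁺ˡ a′∈)
      (trans (⊕ᶠ-↑ˡ _) (trans (cong (_↑ˡ r₂) eq) (sym (⊕ᶠ-↑ˡ _)))))

  IsRainbow-⊕ᶠ⁻ʳ : ∀ {S T} → IsRainbow (f ⊕ᶠ g) (S ++ T) → IsRainbow g T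
  IsRainbow-⊕ᶠ⁻ʳ {S} rb .hits b with rb .hits (n ↑ʳ b)
  ... | u , u∈ , eq with splitView n u
  ...   | inr b′ = b′ , ∈-++⁻ʳ S u∈ ,
                   ↑ʳ-injective r₁ _ _ (trans (sym (⊕ᶠ-↑ʳ b′)) (trans eq (⊕ᶠ-↑ʳ b)))
  ...   | inl a  = ⊥-elim (↑ˡ≢↑ʳ (f a) (g b) (trans (sym (⊕ᶠ-↑ˡ a)) (trans eq (⊕ᶠ-↑ʳ b))))
  IsRainbow-⊕ᶠ⁻ʳ {S} rb .injectiveOn b∈ b′∈ eq =
    ↑ʳ-injective n _ _ (rb .injectiveOn (∈-++⁺ʳ S b∈) (∈-++⁺ʳ S b′∈)
      (trans (⊕ᶠ-↑ʳ _) (trans (cong (r₁ ↑ʳ_) eq) (sym (⊕ᶠ-↑ʳ _)))))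

_⊕ᶜ_ : {G : Graph n} {H : Graph m} {r₁ r₂ : ℕ} →
  ProperColoring G r₁ → ProperColoring H r₂ → ProperColoring (G ⊕ H) (r₁ + r₂)
_⊕ᶜ_ {n} {m} {G} {H} {r₁} {r₂} c₁ c₂ =
  record { col = col c₁ ⊕ᶠ col c₂ ; onto = surjective ; proper = proper′ }
  where
  col-↑ˡ : ∀ a → (col c₁ ⊕ᶠ col c₂) (a ↑ˡ m) ≡ col c₁ a ↑ˡ r₂
  col-↑ˡ = ⊕ᶠ-↑ˡ (col c₁) (col c₂)
  col-↑ʳ : ∀ b → (col c₁ ⊕ᶠ col c₂) (n ↑ʳ b) ≡ r₁ ↑ʳ col c₂ b
  col-↑ʳ = ⊕ᶠ-↑ʳ (col c₁) (col c₂)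
  surjective : ∀ j → ∃ λ v → (col c₁ ⊕ᶠ col c₂) v ≡ j
  surjective j with splitView r₁ j
  ... | inl j₁ = let (a , eq) = onto c₁ j₁ in a ↑ˡ m , trans (col-↑ˡ a) (cong (_↑ˡ r₂) eq)
  ... | inr j₂ = let (b , eq) = onto c₂ j₂ in n ↑ʳ b , trans (col-↑ʳ b) (cong (r₁ ↑ʳ_) eq)
  proper′ : Proper (G ⊕ H) (col c₁ ⊕ᶠ col c₂)
  proper′ u v uv eq with splitView n u | splitView n v
  ... | inl a | inl a′ = proper c₁ a a′ (trans (sym (adj-⊕-↑ˡ G H a a′)) uv)
    (↑ˡ-injective r₂ _ _ (trans (sym (col-↑ˡ a)) (trans eq (col-↑ˡ a′))))
  ... | inl a | inr b  with () ← trans (sym (adj-⊕-↑ˡ↑ʳ G H a b)) uv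
  ... | inr b | inl a  with () ← trans (sym (adj-⊕-↑ʳ↑ˡ G H b a)) uv
  ... | inr b | inr b′ = proper c₂ b b′ (trans (sym (adj-⊕-↑ʳ G H b b′)) uv)
    (↑ʳ-injective r₁ _ _ (trans (sym (col-↑ʳ b)) (trans eq (col-↑ʳ b′))))

DistributesOver : Property → Graph n → Graph m → Set
DistributesOver P G H = ∀ S T →
  (Has P (G ⊕ H) (S ++ T) → Has P G S × Has P H T) ×
  (Has P G S × Has P H T → Has P (G ⊕ H) (S ++ T))

module _ (P : Property) {G : Graph n} {H : Graph m} (distributes : DistributesOver P G H) where

  HasCompelling-⊕⁺ : ∀ {r₁ r₂} →
    HasCompelling P G r₁ → HasCompelling P H r₂ → HasCompelling P (G ⊕ H) (r₁ + r₂)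
  HasCompelling-⊕⁺ (c₁ , compelling₁) (c₂ , compelling₂) = c₁ ⊕ᶜ c₂ , compelling
    where
    compelling : Compelling P (c₁ ⊕ᶜ c₂)
    compelling S rc with Vec.splitAt n S
    ... | S₁ , S₂ , refl = proj₂ (distributes S₁ S₂)
      ( compelling₁ S₁ (IsRainbow⇒IsRC c₁ (IsRainbow-⊕ᶠ⁻ˡ (col c₁) (col c₂) rb))
      , compelling₂ S₂ (IsRainbow⇒IsRC c₂ (IsRainbow-⊕ᶠ⁻ʳ (col c₁) (col c₂) rb)))
      where
      rb : IsRainbow (col c₁ ⊕ᶠ col c₂) (S₁ ++ S₂)
      rb = IsRC⇒IsRainbow (c₁ ⊕ᶜ c₂) rc

  HasCompelling-⊕⁻ˡ : HasCompelling P (G ⊕ H) r →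
    Σ[ r′ ∈ ℕ ] (HasCompelling P G r′ × Σ[ T ∈ Subset m ] (Has P H T × r′ + ∣ T ∣ ≡ r))
  HasCompelling-⊕⁻ˡ {r} (c , compelling) =
    let (r′ , (c′ , compelling′) , rainbow) =
          compellingImage P (proper-↑ˡ G H (proper c)) (λ _ → proj₁ ∘ split)
        (S , rc) = rainbowCommittee c′
        extended = IsRainbow⇒IsRC c (extendʳ (onto c) (rainbow rc))
    in r′ , (c′ , compelling′) , F , proj₂ (split (rainbow rc)) , (begin
      r′ + ∣ F ∣     ≡⟨ cong (_+ ∣ F ∣) (IsRC⇒∣S∣≡r c′ rc) ⟨
      ∣ S ∣ + ∣ F ∣  ≡⟨ ∣p++q∣≡∣p∣+∣q∣ S F ⟨
      ∣ S ++ F ∣     ≡⟨ IsRC⇒∣S∣≡r c extended ⟩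
      r              ∎)
    where
    F : Subset m
    F = freshʳ (onto c)
    split : ∀ {S} → IsRainbow (col c ∘ (_↑ˡ m)) S → Has P G S × Has P H F
    split rb = proj₁ (distributes _ _) (compelling _ (IsRainbow⇒IsRC c (extendʳ (onto c) rb)))
    open ≡-Reasoning

  HasCompelling-⊕⁻ʳ : HasCompelling P (G ⊕ H) r →
    Σ[ r′ ∈ ℕ ] (HasCompelling P H r′ × Σ[ S ∈ Subset n ] (Has P G S × ∣ S ∣ + r′ ≡ r))
  HasCompelling-⊕⁻ʳ {r} (c , compelling) =
    let (r′ , (c′ , compelling′) , rainbow) =
          compellingImage P (proper-↑ʳ G H (proper c)) (λ _ → proj₂ ∘ split)
        (T , rc) = rainbowCommittee c′
        extended = IsRainbow⇒IsRC c (extendˡ (onto c) (rainbow rc))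
    in r′ , (c′ , compelling′) , F , proj₁ (split (rainbow rc)) , (begin
      ∣ F ∣ + r′     ≡⟨ cong (∣ F ∣ +_) (IsRC⇒∣S∣≡r c′ rc) ⟨
      ∣ F ∣ + ∣ T ∣  ≡⟨ ∣p++q∣≡∣p∣+∣q∣ F T ⟨
      ∣ F ++ T ∣     ≡⟨ IsRC⇒∣S∣≡r c extended ⟩
      r              ∎)
    where
    F : Subset n
    F = freshˡ (onto c)
    split : ∀ {T} → IsRainbow (col c ∘ (n ↑ʳ_)) T → Has P G F × Has P H T
    split rb = proj₁ (distributes _ _) (compelling _ (IsRainbow⇒IsRC c (extendˡ (onto c) rb)))
    open ≡-Reasoning

module _ (P : Property) (distributes : Distributes P) where

  distributesOver-⨆ : (G : Graph (suc n)) (cs : Vec Comp (suc k)) → DistributesOver P G (⨆ cs)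
  distributesOver-⨆ G (c ∷ [])         = distributes G (cgraph c)
  distributesOver-⨆ G (c ∷ cs@(_ ∷ _)) = distributes G (cgraph c ⊕ ⨆ cs)

  HasCompelling-⨆⁺ : (cs : Vec Comp (suc k)) (χ : Fin (suc k) → ℕ) →
    (∀ i → HasCompelling P (cgraph (lookup cs i)) (χ i)) → HasCompelling P (⨆ cs) (sum (tabulate χ))
  HasCompelling-⨆⁺ (c ∷ []) χ compelling =
    subst (HasCompelling P (cgraph c)) (sym (+-identityʳ (χ zero))) (compelling zero)
  HasCompelling-⨆⁺ (c ∷ cs@(_ ∷ _)) χ compelling = HasCompelling-⊕⁺ P (distributesOver-⨆ (cgraph c) cs)
    (compelling zero) (HasCompelling-⨆⁺ cs (χ ∘ suc) (compelling ∘ suc))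

  sum-mP≤∣S∣ : (cs : Vec Comp (suc k)) (mP : Fin (suc k) → ℕ) →
    (∀ i S → Has P (cgraph (lookup cs i)) S → mP i ≤ ∣ S ∣) →
    ∀ S → Has P (⨆ cs) S → sum (tabulate mP) ≤ ∣ S ∣
  sum-mP≤∣S∣ (c ∷ []) mP minimal S hasP = subst (_≤ ∣ S ∣) (sym (+-identityʳ (mP zero))) (minimal zero S hasP)
  sum-mP≤∣S∣ (c ∷ cs@(_ ∷ _)) mP minimal S hasP with Vec.splitAt (suc (proj₁ c)) S
  ... | S₁ , S₂ , refl =
    let (hasP₁ , hasP₂) = proj₁ (distributesOver-⨆ (cgraph c) cs S₁ S₂) hasP in
    subst (_ ≤_) (sym (∣p++q∣≡∣p∣+∣q∣ S₁ S₂))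
      (+-mono-≤ (minimal zero S₁ hasP₁) (sum-mP≤∣S∣ cs (mP ∘ suc) (minimal ∘ suc) S₂ hasP₂))

  lowerBound-⨆ : (cs : Vec Comp (suc k)) (χ mP : Fin (suc k) → ℕ) →
    (∀ i {r} → HasCompelling P (cgraph (lookup cs i)) r → χ i ≤ r) →
    (∀ i S → Has P (cgraph (lookup cs i)) S → mP i ≤ ∣ S ∣) →
    HasCompelling P (⨆ cs) r → ∀ i → χ i + sum (removeAt (tabulate mP) i) ≤ r
  lowerBound-⨆ (c ∷ []) χ mP χ-minimal mP-minimal compelling zero =
    subst (_≤ _) (sym (+-identityʳ (χ zero))) (χ-minimal zero compelling)
  lowerBound-⨆ {r = r} (c ∷ cs@(_ ∷ _)) χ mP χ-minimal mP-minimal compelling zero =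
    let (r′ , compelling′ , T , hasP , r′+∣T∣≡r) =
          HasCompelling-⊕⁻ˡ P (distributesOver-⨆ (cgraph c) cs) compelling in
    begin
      χ zero + sum (tabulate (mP ∘ suc))
        ≤⟨ +-mono-≤ (χ-minimal zero compelling′) (sum-mP≤∣S∣ cs (mP ∘ suc) (mP-minimal ∘ suc) T hasP) ⟩
      r′ + ∣ T ∣
        ≡⟨ r′+∣T∣≡r ⟩
      r ∎
    where open ≤-Reasoning
  lowerBound-⨆ {r = r} (c ∷ cs@(_ ∷ _)) χ mP χ-minimal mP-minimal compelling (suc i) =
    let (r′ , compelling′ , S , hasP , ∣S∣+r′≡r) =
          HasCompelling-⊕⁻ʳ P (distributesOver-⨆ (cgraph c) cs) compelling in
    begin
      χ (suc i) + (mP zero + sum (removeAt (tabulate (mP ∘ suc)) i))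
        ≡⟨ x∙yz≈y∙xz (χ (suc i)) (mP zero) _ ⟩
      mP zero + (χ (suc i) + sum (removeAt (tabulate (mP ∘ suc)) i))
        ≤⟨ +-mono-≤ (mP-minimal zero S hasP)
             (lowerBound-⨆ cs (χ ∘ suc) (mP ∘ suc) (χ-minimal ∘ suc) (mP-minimal ∘ suc) compelling′ i) ⟩
      ∣ S ∣ + r′
        ≡⟨ ∣S∣+r′≡r ⟩
      r ∎
    where open ≤-Reasoning

module _ (P : Property) (G : Graph n) where

  IsRC? : (c : ProperColoring G r) → ∀ S → Dec (IsRC c S)
  IsRC? c S = all? λ j → any? λ v → ((v ∈? S) ×-dec (col c v ≟ j)) ×-dec
    all? λ w → (w ∈? S) →-dec ((col c w ≟ j) →-dec (w ≟ v))

  Compelling? : (c : ProperColoring G r) → Dec (Compelling P c)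
  Compelling? c with anySubset? (λ S → IsRC? c S ×-dec ¬? (P G S Bool.≟ true))
  ... | yes (S , rc , ¬hasP) = no λ compelling → ¬hasP (compelling S rc)
  ... | no ¬counterexample   = yes λ S rc →
    decidable-stable (P G S Bool.≟ true) λ ¬hasP → ¬counterexample (S , rc , ¬hasP)

  coloring : (f : Fin n → Fin r) → (∀ j → ∃ λ v → f v ≡ j) → Proper G f → ProperColoring G r
  coloring f surjective proper′ = record { col = f ; onto = surjective ; proper = proper′ }

  CompellingMap : (Fin n → Fin r) → Set
  CompellingMap f = Σ[ surjective ∈ (∀ j → ∃ λ v → f v ≡ j) ] Σ[ proper′ ∈ Proper G f ]
    Compelling P (coloring f surjective proper′)

  CompellingMap? : (f : Fin n → Fin r) → Dec (CompellingMap f)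
  CompellingMap? f with all? (λ j → any? λ v → f v ≟ j)
                      | all? (λ u → all? λ v → (adj G u v Bool.≟ true) →-dec ¬? (f u ≟ f v))
  ... | no ¬surjective | _           = no (¬surjective ∘ proj₁)
  ... | yes _          | no ¬proper  = no (¬proper ∘ proj₁ ∘ proj₂)
  ... | yes surjective | yes proper′ =
    map′ (λ compelling → surjective , proper′ , compelling) (proj₂ ∘ proj₂)
      (Compelling? (coloring f surjective proper′))

  CompellingMap-resp : {f g : Fin n → Fin r} → f ≗ g → CompellingMap f → CompellingMap g
  CompellingMap-resp f≗g (surjective , proper′ , compelling) =
    (λ j → let (v , fv≡j) = surjective j in v , trans (sym (f≗g v)) fv≡j) ,
    (λ u v uv gu≡gv → proper′ u v uv (trans (f≗g u) (trans gu≡gv (sym (f≗g v))))) ,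
    λ S rc → compelling S λ j → let (v , (v∈S , gv≡j) , unique) = rc j in
      v , (v∈S , trans (f≗g v) gv≡j) , λ w w∈S fw≡j → unique w w∈S (trans (sym (f≗g w)) fw≡j)

  HasCompelling? : ∀ r → Dec (HasCompelling P G r)
  HasCompelling? r = map′
    (λ (k , surjective , proper′ , compelling) → coloring (finToFun k) surjective proper′ , compelling)
    (λ (c , compelling) → funToFin (col c) ,
      CompellingMap-resp (sym ∘ finToFun-funToFin (col c)) (onto c , proper c , compelling))
    (any? (CompellingMap? ∘ finToFun {r} {n}))

Least : (ℕ → Set) → ℕ → Set
Least Q r = Q r × (∀ r′ → Q r′ → r ≤ r′)

least : {Q : ℕ → Set} → (∀ r → Dec (Q r)) → ∀ N → Q N → Σ[ r ∈ ℕ ] (Least Q r × r ≤ N)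
least {Q} Q? = <-rec _ go
  where
  go : ∀ N → (∀ {M} → M < N → Q M → Σ[ r ∈ ℕ ] (Least Q r × r ≤ M)) →
    Q N → Σ[ r ∈ ℕ ] (Least Q r × r ≤ N)
  go N rec qN with anyUpTo? Q? N
  ... | yes (M , M<N , qM) = let (r , least-r , r≤M) = rec M<N qM in r , least-r , ≤-trans r≤M (<⇒≤ M<N)
  ... | no none = N , (qN , λ r′ qr′ → ≮⇒≥ λ r′<N → none (r′ , r′<N , qr′)) , ≤-refl

mainTheorem4 : (P : Property) → Distributes P →
    (k : ℕ) (Gs : Vec Comp (suc (suc k))) →
    (∀ i → Connected (cgraph (lookup Gs i))) →
    (∀ i → Σ[ r ∈ ℕ ] HasCompelling P (cgraph (lookup Gs i)) r) →
    (χ m : Fin (suc (suc k)) → ℕ) →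
    (∀ i → IsChiP P (cgraph (lookup Gs i)) (χ i)) →
    (∀ i → IsMP P (cgraph (lookup Gs i)) (m i)) →
    Σ[ χG ∈ ℕ ] (IsChiP P (⨆ Gs) χG ×
      (∀ i → χ i + sum (removeAt (tabulate m) i) ≤ χG) ×
      χG ≤ sum (tabulate χ))
mainTheorem4 P distributes k Gs _ _ χ mP χ-isChiP mP-isMP =
  let (χG , χG-isChiP , χG≤sum) =
        least (HasCompelling? P (⨆ Gs)) _ (HasCompelling-⨆⁺ P distributes Gs χ (proj₁ ∘ χ-isChiP))
  in χG , χG-isChiP ,
     lowerBound-⨆ P distributes Gs χ mP (λ i → proj₂ (χ-isChiP i) _) (λ i → proj₂ (mP-isMP i))
       (proj₁ χG-isChiP) ,
     χG≤sum
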